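{- Let $P(\mathbf{x})=\sum_\alpha c_\alpha\mathbf{x}^\alpha\in\mathbb{Z}[x_1,\ldots,x_n]$ be a polynomial with no constant term. Suppose there exists a prime $p$ such that: (1) the congruence $\sum_\alpha c_\alpha z^{|\alpha|}\equiv0\pmod p$ has no solution $z\not\equiv0\pmod p$; (2) for every Rado set $J$ of minimal indexes of $P$, the congruence $\sum_{\alpha\in J}c_\alpha z^{|\alpha|}\equiv0\pmod p$ has no solution $z\not\equiv0\pmod p$. Then $P$ is not partition regular on $\mathbb{N}$ except possibly for constant solutions; i.e., there is a finite partition of $\mathbb{N}$ none of whose pieces contains $a_1,\ldots,a_n$, not all equal, with $P(a_1,\ldots,a_n)=0$.
   Context: $\mathbb{N}$ is the set of positive integers. Multi-indexes are $\alpha=(\alpha_1,\ldots,\alpha_n)\in\mathbb{N}_0^n$, $\mathbf{x}^\alpha=\prod_i x_i^{\alpha_i}$, $|\alpha|=\sum_i\alpha_i$; $\alpha\le\beta$ means $\alpha_i\le\beta_i$ for all $i$, and $\alpha<\beta$ means $\alpha\le\beta$, $\alpha\ne\beta$. $\mathrm{supp}(P)=\{\alpha\mid c_\alpha\ne0\}$. An index $\alpha\in\mathrm{supp}(P)$ is minimal if there is no $\beta\in\mathrm{supp}(P)$ with $\beta<\alpha$. A nonempty $J\subseteq\mathrm{supp}(P)$ is a Rado set of indexes if for all $\alpha,\beta\in J$ there is a nonempty $\Lambda\subseteq\{1,\ldots,n\}$ with $\sum_{i\in\Lambda}\alpha_i=\sum_{i\in\Lambda}\beta_i$. A Rado set of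 minimal indexes is a Rado set consisting of minimal indexes. -}

module Defs where

open import Data.Nat as ℕ using (ℕ; zero; suc)
open import Data.Integer as ℤ using (ℤ; +_)
open import Data.Integer.Divisibility using () renaming (_∣_ to _∣ℤ_)
open import Data.Fin using (Fin)
open import Data.Fin.Subset using (Subset; Nonempty; inside)
open import Data.Vec using (Vec; lookup; foldr; zipWith; map; toList)
open import Data.List as L using (List)
open import Data.List.Membership.Propositional using (_∈_)
open import Data.List.Relation.Unary.All using (All)
open import Data.List.Relation.Unary.Unique.Propositional using (Unique)
open import Data.List.Relation.Binary.Sublist.Propositional using (_⊆_)
open import Data.Product using (Σ; _×_; _,_; proj₁; proj₂; ∃)
open import Data.Bool using (Bool; true; false; if_then_else_)
open import Relation.Binary.PropositionalEquality using (_≡_; _≢_)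
open import Relation.Nullary using (¬_)

MultiIndex : ℕ → Set
MultiIndex n = Vec ℕ n

∣_∣ᵢ : ∀ {n} → MultiIndex n → ℕ
∣ α ∣ᵢ = foldr _ ℕ._+_ 0 α

_≤ᵢ_ : ∀ {n} → MultiIndex n → MultiIndex n → Set
α ≤ᵢ β = ∀ i → lookup α i ℕ.≤ lookup β i

_<ᵢ_ : ∀ {n} → MultiIndex n → MultiIndex n → Set
α <ᵢ β = α ≤ᵢ β × α ≢ β

Term : ℕ → Set
Term n = ℤ × MultiIndex n

-- A polynomial in ℤ[x₁,…,xₙ] in canonical form: a finite list of terms with
-- pairwise distinct exponents and nonzero coefficients.  Hence the exponents
-- occurring in the list are exactly supp(P).
record Poly (n : ℕ) : Set where
  constructor mkPoly
  field
    terms    : List (Term n)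
    distinct : Unique (L.map proj₂ terms)
    nonzero  : All (λ t → proj₁ t ≢ + 0) terms
open Poly public

_∈supp_ : ∀ {n} → MultiIndex n → Poly n → Set
α ∈supp P = α ∈ L.map proj₂ (terms P)

NoConstantTerm : ∀ {n} → Poly n → Set
NoConstantTerm {n} P = ¬ (Data.Vec.replicate n 0 ∈supp P)

Minimal : ∀ {n} → Poly n → MultiIndex n → Set
Minimal P α = α ∈supp P × (∀ β → β ∈supp P → ¬ (β <ᵢ α))

sumOver : ∀ {n} → Subset n → MultiIndex n → ℕ
sumOver Λ α = foldr _ ℕ._+_ 0 (zipWith (λ b a → if b then a else 0) Λ α)

-- A set J of terms of P (given as a sub-collection of the term list, so
-- J ⊆ supp(P)) is a Rado set of minimal indexes.
RadoSetOfMinimal : ∀ {n} → Poly n → List (Term n) → Set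
RadoSetOfMinimal {n} P J =
  (J ≢ L.[]) ×
  (J ⊆ terms P) ×
  All (λ t → Minimal P (proj₂ t)) J ×
  (∀ s t → s ∈ J → t ∈ J →
     Σ (Subset n) λ Λ → Nonempty Λ × sumOver Λ (proj₂ s) ≡ sumOver Λ (proj₂ t))

sumℤ : List ℤ → ℤ
sumℤ = L.foldr ℤ._+_ (+ 0)

diagSum : ∀ {n} → List (Term n) → ℤ → ℤ
diagSum T z = sumℤ (L.map (λ t → proj₁ t ℤ.* (z ℤ.^ ∣ proj₂ t ∣ᵢ)) T)

NoNonzeroSolutionMod : ∀ {n} → ℕ → List (Term n) → Set
NoNonzeroSolutionMod p T = ∀ (z : ℤ) → ¬ ((+ p) ∣ℤ z) → ¬ ((+ p) ∣ℤ diagSum T z)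

monomial : ∀ {n} → MultiIndex n → (Fin n → ℕ) → ℤ
monomial {n} α a = foldr _ ℤ._*_ (+ 1)
  (Data.Vec.tabulate (λ i → (+ a i) ℤ.^ lookup α i))

eval : ∀ {n} → Poly n → (Fin n → ℕ) → ℤ
eval P a = sumℤ (L.map (λ t → proj₁ t ℤ.* monomial (proj₂ t) a) (terms P))

NotPRExceptConstant : ∀ {n} → Poly n → Set
NotPRExceptConstant {n} P =
  Σ ℕ λ r → Σ (ℕ → Fin r) λ χ →
    ∀ (a : Fin n → ℕ) →
      (∀ i → 1 ℕ.≤ a i) →
      (∀ i j → χ (a i) ≡ χ (a j)) →
      ¬ (∀ i j → a i ≡ a j) →
      eval P a ≢ + 0

-- Write a ≥ 1 as a = p^v(a)·u(a) with p ∤ u(a) and colour a by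
--   (u(a) mod p, [v(a) > 0], v(v(a)) mod K, u(v(a)) mod p^K),
-- where K exceeds the total degree of every monomial of P.  Let a be a
-- monochromatic zero of P, vᵢ = v(aᵢ), uᵢ = u(aᵢ) ≡ z (mod p), p ∤ z.  The
-- weight α·v = Σ αᵢvᵢ governs the p-adic size of the monomial aᵅ, and
-- collecting the terms of least weight m gives
--   0 = P(a) = p^m · (Σ_{α·v=m} c_α uᵅ + p·R),   so   p ∣ Σ_{α·v=m} c_α z^|α|.
-- If all vᵢ = 0, every term has weight 0 and condition (1) fails.  If all
-- vᵢ ≥ 1, the terms of least weight have minimal indexes, and they form a
-- Rado set: writing vᵢ = p^sᵢ·rᵢ and Λ = {i | sᵢ least}, the colouring makes
-- α·v ≡ p^s₀·R·Σ_{i∈Λ} αᵢ modulo p^(s₀+K), so equal weights give equal sums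
-- over Λ.  Then condition (2) fails.
module Submission where

open import Defs
open import Data.Nat as ℕ
  using (ℕ; zero; suc; _+_; _*_; _^_; _∸_; _≤_; _<_; z≤n; s≤s; NonZero; _≟_)
open import Data.Nat.Properties
open import Data.Nat.Divisibility
  using (_∣_; _∣?_; _∣0; divides; quotient; quotient-<; quotient≢0; m∣n⇒n≡m*quotient;
         ∣⇒≤; m∣m*n; ∣m+n∣m⇒∣n; ∣m∣n⇒∣m+n; ∣-trans; *-monoˡ-∣; *-cancelʳ-∣)
open import Data.Nat.DivMod using (_%_; _/_; _mod_; m≡m%n+[m/n]*n)
open import Data.Nat.Primality using (Prime; euclidsLemma; prime⇒nonZero; prime⇒nonTrivial)
open import Data.Integer as ℤ using (ℤ; +_)
import Data.Integer.Properties as ℤₚ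
open import Data.Integer.Divisibility using () renaming (_∣_ to _∣ℤ_)
open import Data.Integer.Divisibility.Signed using (divides; ∣⇒∣ᵤ)
open import Data.Fin as Fin using (Fin; zero; suc; combine)
open import Data.Fin.Properties using (combine-injective; toℕ-fromℕ<)
open import Data.Fin.Subset using (Subset; Nonempty; inside)
open import Data.Vec using ([]; _∷_; lookup; tabulate; _[_]=_)
open import Data.Vec.Properties using (lookup∘tabulate; lookup⇒[]=)
open import Data.List as List using (List; []; _∷_; filter; allFin)
open import Data.List.Properties using (filter-accept; filter-reject; filter-all)
open import Data.List.Relation.Unary.All as All using (All; []; _∷_)
open import Data.List.Relation.Unary.Any using (here; there)
open import Data.List.Membership.Propositional using (_∈_)
open import Data.List.Membership.Propositional.Properties
  using (∈-filter⁺; ∈-filter⁻; ∈-map⁺; ∈-map⁻; ∈-allFin)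
open import Data.List.Relation.Binary.Sublist.Propositional using (⊆-refl)
open import Data.List.Relation.Binary.Sublist.Heterogeneous.Properties using (filter-Sublist)
import Data.List.Extrema.Nat as Extrema
open import Data.Bool using (Bool; true; false; if_then_else_)
open import Data.Product using (Σ; _×_; _,_; proj₁; proj₂; ∃; map₁)
open import Data.Sum using (inj₁; inj₂)
open import Data.Empty using (⊥; ⊥-elim)
open import Function using (_∘_)
open import Relation.Nullary using (¬_; Dec; yes; no; does)
open import Relation.Nullary.Decidable using (dec-true)
open import Relation.Binary.PropositionalEquality hiding (J)
open import Data.Nat.Tactic.RingSolver using (solve-∀)
import Data.Integer.Tactic.RingSolver as ℤ-Solver

-- The p-adic decomposition a = p ^ valuation a * unit a.

module PAdic (p : ℕ) (1<p : 1 < p) where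

  split : (fuel a : ℕ) → ℕ × ℕ
  split zero       a = 0 , a
  split (suc fuel) a with p ∣? a
  ... | yes p∣a = map₁ suc (split fuel (quotient p∣a))
  ... | no  _   = 0 , a

  split-correct : ∀ fuel a → a ≡ p ^ proj₁ (split fuel a) * proj₂ (split fuel a)
  split-correct zero       a = sym (+-identityʳ a)
  split-correct (suc fuel) a with p ∣? a
  ... | no  _   = sym (+-identityʳ a)
  ... | yes p∣a = begin
      a               ≡⟨ m∣n⇒n≡m*quotient p∣a ⟩
      p * q           ≡⟨ cong (p *_) (split-correct fuel q) ⟩
      p * (p ^ k * u) ≡⟨ *-assoc p (p ^ k) u ⟨
      p * p ^ k * u   ∎
    where
    open ≡-Reasoning
    q k u : ℕ
    q = quotient p∣a
    k = proj₁ (split fuel q)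
    u = proj₂ (split fuel q)

  -- Each division strictly decreases a ≥ 1, so fuel a suffices to remove
  -- every factor p.
  split-exhaustive : ∀ fuel a → 1 ≤ a → a ≤ fuel → ¬ p ∣ proj₂ (split fuel a)
  split-exhaustive zero       a 1≤a a≤0 = ⊥-elim (<⇒≱ 1≤a a≤0)
  split-exhaustive (suc fuel) a 1≤a a≤fuel+1 with p ∣? a
  ... | no p∤a  = p∤a
  ... | yes p∣a = split-exhaustive fuel (quotient p∣a) 1≤q q≤fuel
    where
    instance
      p-nonTrivial : ℕ.NonTrivial p
      p-nonTrivial = ℕ.n>1⇒nonTrivial 1<p
      a≢0 : NonZero a
      a≢0 = ℕ.>-nonZero 1≤a
    1≤q : 1 ≤ quotient p∣a
    1≤q = ℕ.>-nonZero⁻¹ _ {{quotient≢0 p∣a}}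
    q≤fuel : quotient p∣a ≤ fuel
    q≤fuel = ≤-pred (<-≤-trans (quotient-< p∣a) a≤fuel+1)

  valuation unit : ℕ → ℕ
  valuation a = proj₁ (split a a)
  unit      a = proj₂ (split a a)

  valuation-unit : ∀ a → a ≡ p ^ valuation a * unit a
  valuation-unit a = split-correct a a

  unit-coprime : ∀ {a} → 1 ≤ a → ¬ p ∣ unit a
  unit-coprime {a} 1≤a = split-exhaustive a a 1≤a ≤-refl

n<p^n : ∀ {p} → 1 < p → ∀ n → n < p ^ n
n<p^n     1<p zero    = s≤s z≤n
n<p^n {p} 1<p (suc n) = begin-strict
    suc n     ≤⟨ n<p^n 1<p n ⟩
    p ^ n     <⟨ m<m*n (p ^ n) p 1<p ⟩
    p ^ n * p ≡⟨ *-comm (p ^ n) p ⟩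
    p ^ suc n ∎
  where
  open ≤-Reasoning
  instance
    p≢0 : NonZero p
    p≢0 = ℕ.>-nonZero (<-trans (s≤s z≤n) 1<p)
    p^n≢0 : NonZero (p ^ n)
    p^n≢0 = m^n≢0 p n

prime-power-cancel : ∀ {p} → Prime p → ∀ {R} → ¬ p ∣ R → ∀ K x → p ^ K ∣ R * x → p ^ K ∣ x
prime-power-cancel     _       _   zero    x _ = divides x (sym (*-identityʳ x))
prime-power-cancel {p} p-prime {R} p∤R (suc K) x p^K⁺¹∣Rx
  with euclidsLemma R x p-prime (∣-trans (divides (p ^ K) (*-comm p (p ^ K))) p^K⁺¹∣Rx)
... | inj₁ p∣R = ⊥-elim (p∤R p∣R)
... | inj₂ (divides y refl) =
  subst (_∣ y * p) (*-comm (p ^ K) p) (*-monoˡ-∣ p p^K∣y)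
  where
  p^K∣y : p ^ K ∣ y
  p^K∣y = prime-power-cancel p-prime p∤R K y
    (*-cancelʳ-∣ p {{prime⇒nonZero p-prime}}
      (subst₂ _∣_ (*-comm p (p ^ K)) (sym (*-assoc R y p)) p^K⁺¹∣Rx))

congruent-gap : ∀ K .{{_ : NonZero K}} {a b} → a ≤ b → a % K ≡ b % K → a ≢ b → a + K ≤ b
congruent-gap K {a} {b} a≤b a≡b ab≢ = begin
    a + K                     ≡⟨ cong (_+ K) (m≡m%n+[m/n]*n a K) ⟩
    a % K + a / K * K + K     ≡⟨ +-assoc (a % K) _ K ⟩
    a % K + (a / K * K + K)   ≡⟨ cong₂ _+_ a≡b (+-comm (a / K * K) K) ⟩
    b % K + suc (a / K) * K   ≤⟨ +-monoʳ-≤ (b % K) (*-monoˡ-≤ K a/K<b/K) ⟩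
    b % K + b / K * K         ≡⟨ m≡m%n+[m/n]*n b K ⟨
    b                         ∎
  where
  open ≤-Reasoning
  a/K<b/K : a / K < b / K
  a/K<b/K = *-cancelʳ-< K _ _ (+-cancelˡ-< (a % K) _ _
    (subst₂ _<_ (m≡m%n+[m/n]*n a K) (trans (m≡m%n+[m/n]*n b K) (cong (_+ b / K * K) (sym a≡b)))
            (≤∧≢⇒< a≤b ab≢)))

cancel-invertible-≤ : ∀ {M R Sa Sb} X Y → (∀ x → M ∣ R * x → M ∣ x) → Sa ≤ Sb → Sb < M →
  R * Sa + M * X ≡ R * Sb + M * Y → Sa ≡ Sb
cancel-invertible-≤ {M} {R} {Sa} X Y invertible Sa≤Sb Sb<M eq
  with m≤n⇒∃[o]m+o≡n Sa≤Sb
... | zero  , refl = sym (+-identityʳ Sa)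
... | suc d , refl = ⊥-elim (<⇒≱ Sb<M (≤-trans (∣⇒≤ M∣d+1) (m≤n+m (suc d) Sa)))
  where
  Md-shift : M * X ≡ R * suc d + M * Y
  Md-shift = +-cancelˡ-≡ (R * Sa) _ _ (trans eq (shift R Sa (suc d) (M * Y)))
    where
    shift : ∀ R a b c → R * (a + b) + c ≡ R * a + (R * b + c)
    shift = solve-∀
  M∣d+1 : M ∣ suc d
  M∣d+1 = invertible (suc d)
    (∣m+n∣m⇒∣n (subst (M ∣_) (trans Md-shift (+-comm (R * suc d) (M * Y))) (m∣m*n X)) (m∣m*n Y))

cancel-invertible : ∀ {M R Sa Sb} X Y → (∀ x → M ∣ R * x → M ∣ x) → Sa < M → Sb < M →
  R * Sa + M * X ≡ R * Sb + M * Y → Sa ≡ Sb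
cancel-invertible {R = R} {Sa} {Sb} X Y invertible Sa<M Sb<M eq with ≤-total Sa Sb
... | inj₁ Sa≤Sb = cancel-invertible-≤ {R = R} X Y invertible Sa≤Sb Sb<M eq
... | inj₂ Sb≤Sa = sym (cancel-invertible-≤ {R = R} Y X invertible Sb≤Sa Sa<M (sym eq))

weight : ∀ {n} → MultiIndex n → (Fin n → ℕ) → ℕ
weight []      v = 0
weight (x ∷ α) v = x * v zero + weight α (v ∘ suc)

weight-mono : ∀ {n} (β α : MultiIndex n) (v : Fin n → ℕ) → β ≤ᵢ α → weight β v ≤ weight α v
weight-mono []      []      v β≤α = z≤n
weight-mono (_ ∷ β) (_ ∷ α) v β≤α =
  +-mono-≤ (*-monoˡ-≤ (v zero) (β≤α zero)) (weight-mono β α (v ∘ suc) (β≤α ∘ suc))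

weight-strict : ∀ {n} (β α : MultiIndex n) (v : Fin n → ℕ) → (∀ i → 1 ≤ v i) →
  β <ᵢ α → weight β v < weight α v
weight-strict []      []      v v≥1 (_ , β≢α) = ⊥-elim (β≢α refl)
weight-strict (y ∷ β) (x ∷ α) v v≥1 (β≤α , β≢α) with y ≟ x
... | yes refl = +-monoʳ-< (y * v zero)
      (weight-strict β α (v ∘ suc) (v≥1 ∘ suc) (β≤α ∘ suc , β≢α ∘ cong (y ∷_)))
... | no  y≢x  = +-mono-<-≤ (*-monoˡ-< (v zero) {{ℕ.>-nonZero (v≥1 zero)}} (≤∧≢⇒< (β≤α zero) y≢x))
      (weight-mono β α (v ∘ suc) (β≤α ∘ suc))

weight-zero : ∀ {n} (α : MultiIndex n) {v : Fin n → ℕ} → (∀ i → v i ≡ 0) → weight α v ≡ 0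
weight-zero []      v≡0 = refl
weight-zero (x ∷ α) v≡0 rewrite v≡0 zero | weight-zero α (v≡0 ∘ suc) | *-zeroʳ x = refl

sumOver≤degree : ∀ {n} (Λ : Subset n) (α : MultiIndex n) → sumOver Λ α ≤ ∣ α ∣ᵢ
sumOver≤degree []          []      = z≤n
sumOver≤degree (true  ∷ Λ) (x ∷ α) = +-monoʳ-≤ x (sumOver≤degree Λ α)
sumOver≤degree (false ∷ Λ) (x ∷ α) = ≤-trans (sumOver≤degree Λ α) (m≤n+m _ x)

module WeightExpansion (p K R s₀ : ℕ) .{{_ : NonZero (p ^ K)}} where

  weight-expansion : ∀ {n} (α : MultiIndex n) (Λ : Subset n) (v s r : Fin n → ℕ) →
    (∀ i → v i ≡ p ^ s i * r i) →
    (∀ i → if lookup Λ i then s i ≡ s₀ else s₀ + K ≤ s i) →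
    (∀ i → r i % p ^ K ≡ R) →
    ∃ λ X → weight α v ≡ p ^ s₀ * (R * sumOver Λ α + p ^ K * X)
  weight-expansion [] [] v s r _ _ _ = 0 , trivial (p ^ s₀) R (p ^ K)
    where
    trivial : ∀ P R M → 0 ≡ P * (R * 0 + M * 0)
    trivial = solve-∀
  weight-expansion (x ∷ α) (true ∷ Λ) v s r v≡ sΛ r≡
    with weight-expansion α Λ (v ∘ suc) (s ∘ suc) (r ∘ suc) (v≡ ∘ suc) (sΛ ∘ suc) (r≡ ∘ suc)
  ... | X , eqX = x * (r zero / p ^ K) + X , (begin
      x * v zero + weight α (v ∘ suc)
        ≡⟨ cong₂ (λ a b → x * a + b) (v≡ zero) eqX ⟩
      x * (p ^ s zero * r zero) + p ^ s₀ * (R * S + p ^ K * X)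
        ≡⟨ cong (λ e → x * (p ^ e * r zero) + p ^ s₀ * (R * S + p ^ K * X)) (sΛ zero) ⟩
      x * (p ^ s₀ * r zero) + p ^ s₀ * (R * S + p ^ K * X)
        ≡⟨ cong (λ a → x * (p ^ s₀ * a) + p ^ s₀ * (R * S + p ^ K * X)) r₀≡ ⟩
      x * (p ^ s₀ * (R + r zero / p ^ K * p ^ K)) + p ^ s₀ * (R * S + p ^ K * X)
        ≡⟨ regroup x (p ^ s₀) R (r zero / p ^ K) (p ^ K) S X ⟩
      p ^ s₀ * (R * (x + S) + p ^ K * (x * (r zero / p ^ K) + X)) ∎)
    where
    open ≡-Reasoning
    S : ℕ
    S = sumOver Λ α
    r₀≡ : r zero ≡ R + r zero / p ^ K * p ^ K
    r₀≡ = trans (m≡m%n+[m/n]*n (r zero) (p ^ K)) (cong (_+ _) (r≡ zero))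
    regroup : ∀ x P R q M S X →
      x * (P * (R + q * M)) + P * (R * S + M * X) ≡ P * (R * (x + S) + M * (x * q + X))
    regroup = solve-∀
  weight-expansion (x ∷ α) (false ∷ Λ) v s r v≡ sΛ r≡
    with weight-expansion α Λ (v ∘ suc) (s ∘ suc) (r ∘ suc) (v≡ ∘ suc) (sΛ ∘ suc) (r≡ ∘ suc)
  ... | X , eqX = p ^ d * r zero * x + X , (begin
      x * v zero + weight α (v ∘ suc)
        ≡⟨ cong₂ (λ a b → x * a + b) (v≡ zero) eqX ⟩
      x * (p ^ s zero * r zero) + p ^ s₀ * (R * S + p ^ K * X)
        ≡⟨ cong (λ e → x * (p ^ e * r zero) + p ^ s₀ * (R * S + p ^ K * X)) (sym s≡) ⟩
      x * (p ^ (s₀ + K + d) * r zero) + p ^ s₀ * (R * S + p ^ K * X)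
        ≡⟨ cong (λ a → x * (a * r zero) + p ^ s₀ * (R * S + p ^ K * X)) p^s≡ ⟩
      x * (p ^ s₀ * p ^ K * p ^ d * r zero) + p ^ s₀ * (R * S + p ^ K * X)
        ≡⟨ regroup x (p ^ s₀) R (p ^ d) (r zero) (p ^ K) S X ⟩
      p ^ s₀ * (R * (0 + S) + p ^ K * (p ^ d * r zero * x + X)) ∎)
    where
    open ≡-Reasoning
    S d : ℕ
    S = sumOver Λ α
    d = s zero ∸ (s₀ + K)
    s≡ : s₀ + K + d ≡ s zero
    s≡ = m+[n∸m]≡n (sΛ zero)
    p^s≡ : p ^ (s₀ + K + d) ≡ p ^ s₀ * p ^ K * p ^ d
    p^s≡ = trans (^-distribˡ-+-* p (s₀ + K) d) (cong (_* p ^ d) (^-distribˡ-+-* p s₀ K))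
    regroup : ∀ x P R D r M S X →
      x * (P * M * D * r) + P * (R * S + M * X) ≡ P * (R * (0 + S) + M * (D * r * x + X))
    regroup = solve-∀

^-distribʳ-* : ∀ (i j : ℤ) n → (i ℤ.* j) ℤ.^ n ≡ i ℤ.^ n ℤ.* j ℤ.^ n
^-distribʳ-* i j zero    = refl
^-distribʳ-* i j (suc n) = begin
    i ℤ.* j ℤ.* (i ℤ.* j) ℤ.^ n           ≡⟨ cong (i ℤ.* j ℤ.*_) (^-distribʳ-* i j n) ⟩
    i ℤ.* j ℤ.* (i ℤ.^ n ℤ.* j ℤ.^ n)     ≡⟨ interchange i j (i ℤ.^ n) (j ℤ.^ n) ⟩
    i ℤ.* i ℤ.^ n ℤ.* (j ℤ.* j ℤ.^ n)     ∎
  where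
  open ≡-Reasoning
  interchange : ∀ a b c d → a ℤ.* b ℤ.* (c ℤ.* d) ≡ a ℤ.* c ℤ.* (b ℤ.* d)
  interchange = ℤ-Solver.solve-∀

pos-^ : ∀ a n → + (a ^ n) ≡ (+ a) ℤ.^ n
pos-^ a zero    = refl
pos-^ a (suc n) = trans (ℤₚ.pos-* a (a ^ n)) (cong (+ a ℤ.*_) (pos-^ a n))

monomial-cong : ∀ {n} (α : MultiIndex n) {a b : Fin n → ℕ} → (∀ i → a i ≡ b i) →
  monomial α a ≡ monomial α b
monomial-cong []      a≡b = refl
monomial-cong (x ∷ α) a≡b =
  cong₂ (λ c m → (+ c) ℤ.^ x ℤ.* m) (a≡b zero) (monomial-cong α (a≡b ∘ suc))

monomial-* : ∀ {n} (α : MultiIndex n) (a b : Fin n → ℕ) →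
  monomial α (λ i → a i * b i) ≡ monomial α a ℤ.* monomial α b
monomial-* []      a b = refl
monomial-* (x ∷ α) a b = begin
    (+ (a zero * b zero)) ℤ.^ x ℤ.* monomial α (λ i → a (suc i) * b (suc i))
      ≡⟨ cong₂ (λ c m → c ℤ.^ x ℤ.* m) (ℤₚ.pos-* (a zero) (b zero)) (monomial-* α (a ∘ suc) (b ∘ suc)) ⟩
    (+ a zero ℤ.* + b zero) ℤ.^ x ℤ.* (monomial α (a ∘ suc) ℤ.* monomial α (b ∘ suc))
      ≡⟨ cong (ℤ._* _) (^-distribʳ-* (+ a zero) (+ b zero) x) ⟩
    (+ a zero) ℤ.^ x ℤ.* (+ b zero) ℤ.^ x ℤ.* (monomial α (a ∘ suc) ℤ.* monomial α (b ∘ suc))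
      ≡⟨ interchange ((+ a zero) ℤ.^ x) _ _ _ ⟩
    (+ a zero) ℤ.^ x ℤ.* monomial α (a ∘ suc) ℤ.* ((+ b zero) ℤ.^ x ℤ.* monomial α (b ∘ suc)) ∎
  where
  open ≡-Reasoning
  interchange : ∀ a b c d → a ℤ.* b ℤ.* (c ℤ.* d) ≡ a ℤ.* c ℤ.* (b ℤ.* d)
  interchange = ℤ-Solver.solve-∀

monomial-power : ∀ {n} (α : MultiIndex n) (p : ℕ) (v : Fin n → ℕ) →
  monomial α (λ i → p ^ v i) ≡ (+ p) ℤ.^ weight α v
monomial-power []      p v = refl
monomial-power (x ∷ α) p v = begin
    (+ (p ^ v zero)) ℤ.^ x ℤ.* monomial α (λ i → p ^ v (suc i))
      ≡⟨ cong₂ (λ c m → c ℤ.^ x ℤ.* m) (pos-^ p (v zero)) (monomial-power α p (v ∘ suc)) ⟩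
    ((+ p) ℤ.^ v zero) ℤ.^ x ℤ.* (+ p) ℤ.^ weight α (v ∘ suc)
      ≡⟨ cong (ℤ._* _) (trans (ℤₚ.^-*-assoc (+ p) (v zero) x) (cong ((+ p) ℤ.^_) (*-comm (v zero) x))) ⟩
    (+ p) ℤ.^ (x * v zero) ℤ.* (+ p) ℤ.^ weight α (v ∘ suc)
      ≡⟨ ℤₚ.^-distribˡ-+-* (+ p) (x * v zero) (weight α (v ∘ suc)) ⟨
    (+ p) ℤ.^ (x * v zero + weight α (v ∘ suc)) ∎
  where open ≡-Reasoning

monomial-split : ∀ {n} (α : MultiIndex n) (p : ℕ) (a v u : Fin n → ℕ) →
  (∀ i → a i ≡ p ^ v i * u i) → monomial α a ≡ (+ p) ℤ.^ weight α v ℤ.* monomial α u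
monomial-split α p a v u a≡ = begin
    monomial α a                                        ≡⟨ monomial-cong α a≡ ⟩
    monomial α (λ i → p ^ v i * u i)                    ≡⟨ monomial-* α (λ i → p ^ v i) u ⟩
    monomial α (λ i → p ^ v i) ℤ.* monomial α u         ≡⟨ cong (ℤ._* _) (monomial-power α p v) ⟩
    (+ p) ℤ.^ weight α v ℤ.* monomial α u               ∎
  where open ≡-Reasoning

-- The expansion of P(a) by weight.

evalTerms : ∀ {n} → List (Term n) → (Fin n → ℕ) → ℤ
evalTerms T a = sumℤ (List.map (λ t → proj₁ t ℤ.* monomial (proj₂ t) a) T)

weight≟ : ∀ {n} (v : Fin n → ℕ) (m : ℕ) (t : Term n) → Dec (weight (proj₂ t) v ≡ m)
weight≟ v m t = weight (proj₂ t) v ≟ m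

layer : ∀ {n} → (Fin n → ℕ) → ℕ → List (Term n) → List (Term n)
layer v m = filter (weight≟ v m)

evalTerms-expansion : ∀ {n} (p : ℕ) (a v u : Fin n → ℕ) → (∀ i → a i ≡ p ^ v i * u i) →
  ∀ m T → All (λ t → m ≤ weight (proj₂ t) v) T →
  ∃ λ R → evalTerms T a ≡ (+ p) ℤ.^ m ℤ.* (evalTerms (layer v m T) u ℤ.+ + p ℤ.* R)
evalTerms-expansion p a v u a≡ m [] [] = + 0 , trivial ((+ p) ℤ.^ m) (+ p)
  where
  trivial : ∀ Q P → + 0 ≡ Q ℤ.* (+ 0 ℤ.+ P ℤ.* + 0)
  trivial = ℤ-Solver.solve-∀
evalTerms-expansion p a v u a≡ m ((c , α) ∷ T) (m≤w ∷ m≤ws)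
  with evalTerms-expansion p a v u a≡ m T m≤ws | weight α v ≟ m
... | R , eqR | yes w≡m = R , (begin
    c ℤ.* monomial α a ℤ.+ evalTerms T a
      ≡⟨ cong₂ (λ x y → c ℤ.* x ℤ.+ y) (monomial-split α p a v u a≡) eqR ⟩
    c ℤ.* (P ℤ.^ weight α v ℤ.* U) ℤ.+ P ℤ.^ m ℤ.* (S ℤ.+ P ℤ.* R)
      ≡⟨ cong (λ e → c ℤ.* (P ℤ.^ e ℤ.* U) ℤ.+ P ℤ.^ m ℤ.* (S ℤ.+ P ℤ.* R)) w≡m ⟩
    c ℤ.* (P ℤ.^ m ℤ.* U) ℤ.+ P ℤ.^ m ℤ.* (S ℤ.+ P ℤ.* R)
      ≡⟨ regroup c (P ℤ.^ m) U S P R ⟩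
    P ℤ.^ m ℤ.* (c ℤ.* U ℤ.+ S ℤ.+ P ℤ.* R)
      ≡⟨ cong (λ L → P ℤ.^ m ℤ.* (evalTerms L u ℤ.+ P ℤ.* R)) accepted ⟨
    P ℤ.^ m ℤ.* (evalTerms (layer v m ((c , α) ∷ T)) u ℤ.+ P ℤ.* R) ∎)
  where
  open ≡-Reasoning
  P U S : ℤ
  P = + p
  U = monomial α u
  S = evalTerms (layer v m T) u
  accepted : layer v m ((c , α) ∷ T) ≡ (c , α) ∷ layer v m T
  accepted = filter-accept (weight≟ v m) {x = c , α} {xs = T} w≡m
  regroup : ∀ c Q U S P R → c ℤ.* (Q ℤ.* U) ℤ.+ Q ℤ.* (S ℤ.+ P ℤ.* R) ≡ Q ℤ.* (c ℤ.* U ℤ.+ S ℤ.+ P ℤ.* R)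
  regroup = ℤ-Solver.solve-∀
... | R , eqR | no w≢m = c ℤ.* P ℤ.^ k ℤ.* U ℤ.+ R , (begin
    c ℤ.* monomial α a ℤ.+ evalTerms T a
      ≡⟨ cong₂ (λ x y → c ℤ.* x ℤ.+ y) (monomial-split α p a v u a≡) eqR ⟩
    c ℤ.* (P ℤ.^ weight α v ℤ.* U) ℤ.+ P ℤ.^ m ℤ.* (S ℤ.+ P ℤ.* R)
      ≡⟨ cong (λ e → c ℤ.* (P ℤ.^ e ℤ.* U) ℤ.+ P ℤ.^ m ℤ.* (S ℤ.+ P ℤ.* R)) w≡m+1+k ⟩
    c ℤ.* (P ℤ.^ (m + suc k) ℤ.* U) ℤ.+ P ℤ.^ m ℤ.* (S ℤ.+ P ℤ.* R)
      ≡⟨ cong (λ x → c ℤ.* (x ℤ.* U) ℤ.+ P ℤ.^ m ℤ.* (S ℤ.+ P ℤ.* R)) (ℤₚ.^-distribˡ-+-* P m (suc k)) ⟩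
    c ℤ.* (P ℤ.^ m ℤ.* (P ℤ.* P ℤ.^ k) ℤ.* U) ℤ.+ P ℤ.^ m ℤ.* (S ℤ.+ P ℤ.* R)
      ≡⟨ regroup c (P ℤ.^ m) P (P ℤ.^ k) U S R ⟩
    P ℤ.^ m ℤ.* (S ℤ.+ P ℤ.* (c ℤ.* P ℤ.^ k ℤ.* U ℤ.+ R))
      ≡⟨ cong (λ L → P ℤ.^ m ℤ.* (evalTerms L u ℤ.+ P ℤ.* (c ℤ.* P ℤ.^ k ℤ.* U ℤ.+ R))) rejected ⟨
    P ℤ.^ m ℤ.* (evalTerms (layer v m ((c , α) ∷ T)) u ℤ.+ P ℤ.* (c ℤ.* P ℤ.^ k ℤ.* U ℤ.+ R)) ∎)
  where
  open ≡-Reasoning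
  P U S : ℤ
  P = + p
  U = monomial α u
  S = evalTerms (layer v m T) u
  k : ℕ
  k = weight α v ∸ suc m
  rejected : layer v m ((c , α) ∷ T) ≡ layer v m T
  rejected = filter-reject (weight≟ v m) {x = c , α} {xs = T} w≢m
  w≡m+1+k : weight α v ≡ m + suc k
  w≡m+1+k = sym (trans (+-suc m k) (m+[n∸m]≡n (≤∧≢⇒< m≤w (w≢m ∘ sym))))
  regroup : ∀ c Q P Pk U S R →
    c ℤ.* (Q ℤ.* (P ℤ.* Pk) ℤ.* U) ℤ.+ Q ℤ.* (S ℤ.+ P ℤ.* R) ≡ Q ℤ.* (S ℤ.+ P ℤ.* (c ℤ.* Pk ℤ.* U ℤ.+ R))
  regroup = ℤ-Solver.solve-∀

module ModP (p : ℕ) where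

  infix 4 _≈_
  record _≈_ (x y : ℤ) : Set where
    constructor congruent
    field
      quotient : ℤ
      equation : x ≡ y ℤ.+ + p ℤ.* quotient

  ≈-refl : ∀ {x} → x ≈ x
  ≈-refl {x} =
    congruent (+ 0) (sym (trans (cong (λ t → x ℤ.+ t) (ℤₚ.*-zeroʳ (+ p))) (ℤₚ.+-identityʳ x)))

  ≈-+ : ∀ {x y x′ y′} → x ≈ x′ → y ≈ y′ → x ℤ.+ y ≈ x′ ℤ.+ y′
  ≈-+ {x′ = x′} {y′} (congruent w refl) (congruent w′ refl) =
    congruent (w ℤ.+ w′) (regroup x′ y′ (+ p) w w′)
    where
    regroup : ∀ a b P w w′ → a ℤ.+ P ℤ.* w ℤ.+ (b ℤ.+ P ℤ.* w′) ≡ a ℤ.+ b ℤ.+ P ℤ.* (w ℤ.+ w′)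
    regroup = ℤ-Solver.solve-∀

  ≈-* : ∀ {x y x′ y′} → x ≈ x′ → y ≈ y′ → x ℤ.* y ≈ x′ ℤ.* y′
  ≈-* {x′ = x′} {y′} (congruent w refl) (congruent w′ refl) =
    congruent (x′ ℤ.* w′ ℤ.+ w ℤ.* y′ ℤ.+ + p ℤ.* w ℤ.* w′) (regroup x′ y′ (+ p) w w′)
    where
    regroup : ∀ a b P w w′ →
      (a ℤ.+ P ℤ.* w) ℤ.* (b ℤ.+ P ℤ.* w′) ≡ a ℤ.* b ℤ.+ P ℤ.* (a ℤ.* w′ ℤ.+ w ℤ.* b ℤ.+ P ℤ.* w ℤ.* w′)
    regroup = ℤ-Solver.solve-∀

  ≈-^ : ∀ {x x′} → x ≈ x′ → ∀ k → x ℤ.^ k ≈ x′ ℤ.^ k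
  ≈-^ x≈x′ zero    = ≈-refl
  ≈-^ x≈x′ (suc k) = ≈-* x≈x′ (≈-^ x≈x′ k)

  %-≈ : .{{_ : NonZero p}} → ∀ {x y} → x % p ≡ y % p → + x ≈ + y
  %-≈ {x} {y} x%p≡y%p = congruent (+ (x / p) ℤ.- + (y / p)) (begin
      + x                                               ≡⟨ as-ℤ x ⟩
      + (x % p) ℤ.+ + (x / p) ℤ.* P                     ≡⟨ cong (λ e → + e ℤ.+ + (x / p) ℤ.* P) x%p≡y%p ⟩
      + (y % p) ℤ.+ + (x / p) ℤ.* P                     ≡⟨ regroup (+ (y % p)) (+ (x / p)) (+ (y / p)) P ⟩
      + (y % p) ℤ.+ + (y / p) ℤ.* P ℤ.+ P ℤ.* (+ (x / p) ℤ.- + (y / p))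
                                                        ≡⟨ cong (ℤ._+ P ℤ.* (+ (x / p) ℤ.- + (y / p))) (as-ℤ y) ⟨
      + y ℤ.+ P ℤ.* (+ (x / p) ℤ.- + (y / p))           ∎)
    where
    open ≡-Reasoning
    P : ℤ
    P = + p
    as-ℤ : ∀ x → + x ≡ + (x % p) ℤ.+ + (x / p) ℤ.* P
    as-ℤ x = trans (cong +_ (m≡m%n+[m/n]*n x p))
                   (trans (ℤₚ.pos-+ (x % p) _) (cong (λ e → + (x % p) ℤ.+ e) (ℤₚ.pos-* (x / p) p)))
    regroup : ∀ r a b P → r ℤ.+ a ℤ.* P ≡ r ℤ.+ b ℤ.* P ℤ.+ P ℤ.* (a ℤ.- b)
    regroup = ℤ-Solver.solve-∀

  monomial-≈ : ∀ {n} (α : MultiIndex n) {u : Fin n → ℕ} {z} → (∀ i → + u i ≈ z) →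
    monomial α u ≈ z ℤ.^ ∣ α ∣ᵢ
  monomial-≈ []      u≈z = ≈-refl
  monomial-≈ (x ∷ α) {z = z} u≈z =
    subst (_ ≈_) (sym (ℤₚ.^-distribˡ-+-* z x ∣ α ∣ᵢ))
      (≈-* (≈-^ (u≈z zero) x) (monomial-≈ α (u≈z ∘ suc)))

  evalTerms-≈ : ∀ {n} (T : List (Term n)) {u : Fin n → ℕ} {z} → (∀ i → + u i ≈ z) →
    evalTerms T u ≈ diagSum T z
  evalTerms-≈ []            u≈z = ≈-refl
  evalTerms-≈ ((c , α) ∷ T) u≈z = ≈-+ (≈-* (≈-refl {c}) (monomial-≈ α u≈z)) (evalTerms-≈ T u≈z)

  layer-divisible : .{{_ : NonZero p}} → ∀ {n} (T : List (Term n)) (a v u : Fin n → ℕ) →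
    (∀ i → a i ≡ p ^ v i * u i) → ∀ {z} → (∀ i → + u i ≈ z) →
    ∀ m → All (λ t → m ≤ weight (proj₂ t) v) T →
    evalTerms T a ≡ + 0 → + p ∣ℤ diagSum (layer v m T) z
  layer-divisible T a v u a≡ {z} u≈z m m≤w T[a]≡0
    with evalTerms-expansion p a v u a≡ m T m≤w | evalTerms-≈ (layer v m T) u≈z
  ... | R , expansion | congruent w S≡D+Pw = ∣⇒∣ᵤ (divides (ℤ.- (w ℤ.+ R)) D≡)
    where
    P S D : ℤ
    P = + p
    S = evalTerms (layer v m T) u
    D = diagSum (layer v m T) z
    bracket≡0 : S ℤ.+ P ℤ.* R ≡ + 0
    bracket≡0 with ℤₚ.i*j≡0⇒i≡0∨j≡0 (P ℤ.^ m) (trans (sym expansion) T[a]≡0)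
    ... | inj₁ P^m≡0 = ⊥-elim (ℕ.≢-nonZero⁻¹ p (cong ℤ.∣_∣ (ℤₚ.i^n≡0⇒i≡0 P m P^m≡0)))
    ... | inj₂ ≡0    = ≡0
    D≡ : D ≡ ℤ.- (w ℤ.+ R) ℤ.* P
    D≡ = begin
      D                                                ≡⟨ regroup D P w R ⟩
      D ℤ.+ P ℤ.* w ℤ.+ P ℤ.* R ℤ.+ ℤ.- (w ℤ.+ R) ℤ.* P
        ≡⟨ cong (λ x → x ℤ.+ P ℤ.* R ℤ.+ ℤ.- (w ℤ.+ R) ℤ.* P) S≡D+Pw ⟨
      S ℤ.+ P ℤ.* R ℤ.+ ℤ.- (w ℤ.+ R) ℤ.* P             ≡⟨ cong (ℤ._+ ℤ.- (w ℤ.+ R) ℤ.* P) bracket≡0 ⟩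
      + 0 ℤ.+ ℤ.- (w ℤ.+ R) ℤ.* P                       ≡⟨ ℤₚ.+-identityˡ _ ⟩
      ℤ.- (w ℤ.+ R) ℤ.* P                               ∎
      where
      open ≡-Reasoning
      regroup : ∀ D P w R → D ≡ D ℤ.+ P ℤ.* w ℤ.+ P ℤ.* R ℤ.+ ℤ.- (w ℤ.+ R) ℤ.* P
      regroup = ℤ-Solver.solve-∀

-- The lowest layer is a Rado set of minimal indexes.

least : ∀ {A : Set} (f : A → ℕ) x xs → ∃ λ y → y ∈ x ∷ xs × All (λ w → f y ≤ f w) (x ∷ xs)
least {A} f x xs = y , y∈ , Extrema.f[argmin]≤f[⊤] {f = f} x xs ∷ Extrema.f[argmin]≤f[xs] {f = f} x xs
  where
  y : A
  y = Extrema.argmin f x xs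
  y∈ : y ∈ x ∷ xs
  y∈ with Extrema.argmin-sel f x xs
  ... | inj₁ y≡x  = here y≡x
  ... | inj₂ y∈xs = there y∈xs

lowest-weight : ∀ {n} (v : Fin n → ℕ) {t} {T} (T′ : List (Term n)) → T′ ≡ t ∷ T →
  ∃ λ m → All (λ s → m ≤ weight (proj₂ s) v) T′ × layer v m T′ ≢ []
lowest-weight v {t} {T} T′ T′≡ with least (λ s → weight (proj₂ s) v) t T
... | y , y∈ , m≤w = weight (proj₂ y) v , subst (All _) (sym T′≡) m≤w , nonempty
  where
  nonempty : layer v (weight (proj₂ y) v) T′ ≢ []
  nonempty J≡[] with subst (y ∈_) J≡[] (∈-filter⁺ (weight≟ v _) (subst (y ∈_) (sym T′≡) y∈) refl)
  ... | ()

maxDegree : ∀ {n} → List (Term n) → ℕ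
maxDegree []      = 0
maxDegree (t ∷ T) = ∣ proj₂ t ∣ᵢ ℕ.⊔ maxDegree T

maxDegree-≥ : ∀ {n} {t : Term n} {T} → t ∈ T → ∣ proj₂ t ∣ᵢ ≤ maxDegree T
maxDegree-≥ (here refl) = m≤m⊔n _ _
maxDegree-≥ (there t∈T) = ≤-trans (maxDegree-≥ t∈T) (m≤n⊔m _ _)

layer-minimal : ∀ {n} (P : Poly n) (v : Fin n → ℕ) → (∀ i → 1 ≤ v i) → ∀ m →
  All (λ t → m ≤ weight (proj₂ t) v) (terms P) →
  All (λ t → Minimal P (proj₂ t)) (layer v m (terms P))
layer-minimal P v v≥1 m m≤w = All.tabulate minimal
  where
  minimal : ∀ {t} → t ∈ layer v m (terms P) → Minimal P (proj₂ t)
  minimal {t} t∈J with ∈-filter⁻ (weight≟ v m) {xs = terms P} t∈J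
  ... | t∈P , w≡m = ∈-map⁺ proj₂ t∈P , λ β β∈supp β<α → below β (∈-map⁻ proj₂ β∈supp) β<α
    where
    below : ∀ β → (∃ λ s → s ∈ terms P × β ≡ proj₂ s) → ¬ β <ᵢ proj₂ t
    below β (s , s∈P , refl) β<α =
      <⇒≱ (subst (weight β v <_) w≡m (weight-strict β (proj₂ t) v v≥1 β<α)) (All.lookup m≤w s∈P)

levelSet : ∀ {n} → (Fin n → ℕ) → ℕ → Subset n
levelSet s s₀ = tabulate (λ i → does (s i ≟ s₀))

levelSet-gap : ∀ K .{{_ : NonZero K}} {n} (s : Fin n → ℕ) s₀ → (∀ i → s₀ ≤ s i) →
  (∀ i → s₀ % K ≡ s i % K) → ∀ i → if lookup (levelSet s s₀) i then s i ≡ s₀ else s₀ + K ≤ s i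
levelSet-gap K s s₀ s₀≤ s≡ i =
  subst Case (sym (lookup∘tabulate (λ i → does (s i ≟ s₀)) i)) (by (s i ≟ s₀))
  where
  Case : Bool → Set
  Case b = if b then s i ≡ s₀ else s₀ + K ≤ s i
  by : (d : Dec (s i ≡ s₀)) → Case (does d)
  by (yes sᵢ≡s₀) = sᵢ≡s₀
  by (no  sᵢ≢s₀) = congruent-gap K (s₀≤ i) (s≡ i) (sᵢ≢s₀ ∘ sym)

module LevelSet {p} (p-prime : Prime p) (K : ℕ) .{{_ : NonZero K}} where

  instance
    p≢0 : NonZero p
    p≢0 = prime⇒nonZero p-prime
    p^K≢0 : NonZero (p ^ K)
    p^K≢0 = m^n≢0 p K

  level-set-balances : ∀ {n} (v s r : Fin n → ℕ) → Fin n →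
    (∀ i → v i ≡ p ^ s i * r i) → (∀ i → ¬ p ∣ r i) →
    (∀ i j → s i % K ≡ s j % K) → (∀ i j → r i % p ^ K ≡ r j % p ^ K) →
    Σ (Subset n) λ Λ → Nonempty Λ ×
      (∀ α β → ∣ α ∣ᵢ < p ^ K → ∣ β ∣ᵢ < p ^ K →
        weight α v ≡ weight β v → sumOver Λ α ≡ sumOver Λ β)
  level-set-balances {n} v s r i₀ v≡ p∤r s≡ r≡ = Λ , (i* , i*∈Λ) , balanced
    where
    i* : Fin n
    i* = proj₁ (least s i₀ (allFin n))
    s₀ : ℕ
    s₀ = s i*
    s₀≤ : ∀ i → s₀ ≤ s i
    s₀≤ i = All.lookup (proj₂ (proj₂ (least s i₀ (allFin n)))) (there (∈-allFin i))
    Λ : Subset n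
    Λ = levelSet s s₀
    i*∈Λ : Λ [ i* ]= inside
    i*∈Λ = lookup⇒[]= i* Λ (trans (lookup∘tabulate _ i*) (dec-true (s₀ ≟ s₀) refl))
    R : ℕ
    R = r i* % p ^ K
    p∤R : ¬ p ∣ R
    p∤R p∣R = p∤r i* (subst (p ∣_) (sym (m≡m%n+[m/n]*n (r i*) (p ^ K)))
      (∣m∣n⇒∣m+n p∣R (∣-trans (p∣p^K) (divides (r i* / p ^ K) refl))))
      where
      p∣p^K : p ∣ p ^ K
      p∣p^K = subst (λ e → p ∣ p ^ e) (suc-pred K) (m∣m*n (p ^ ℕ.pred K))
    open WeightExpansion p K R s₀
    gap : ∀ i → if lookup Λ i then s i ≡ s₀ else s₀ + K ≤ s i
    gap = levelSet-gap K s s₀ s₀≤ (λ i → s≡ i* i)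
    balanced : ∀ α β → ∣ α ∣ᵢ < p ^ K → ∣ β ∣ᵢ < p ^ K →
      weight α v ≡ weight β v → sumOver Λ α ≡ sumOver Λ β
    balanced α β α<p^K β<p^K wα≡wβ
      with weight-expansion α Λ v s r v≡ gap (λ i → r≡ i i*)
         | weight-expansion β Λ v s r v≡ gap (λ i → r≡ i i*)
    ... | X , wα≡ | Y , wβ≡ =
      cancel-invertible {R = R} X Y (prime-power-cancel p-prime p∤R K)
        (≤-<-trans (sumOver≤degree Λ α) α<p^K) (≤-<-trans (sumOver≤degree Λ β) β<p^K)
        (*-cancelˡ-≡ _ _ (p ^ s₀) {{m^n≢0 p s₀}} (trans (sym wα≡) (trans wα≡wβ wβ≡)))

-- The colouring.

prime>1 : ∀ {p} → Prime p → 1 < p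
prime>1 {p} p-prime = ℕ.nonTrivial⇒n>1 p {{prime⇒nonTrivial p-prime}}

mod-injective : ∀ {M} .{{_ : NonZero M}} {a b} → a mod M ≡ b mod M → a % M ≡ b % M
mod-injective a≡b = trans (sym (toℕ-fromℕ< _)) (trans (cong Fin.toℕ a≡b) (toℕ-fromℕ< _))

infixr 5 _⊗_
_⊗_ : ∀ {r s} → (ℕ → Fin r) → (ℕ → Fin s) → ℕ → Fin (r * s)
(χ ⊗ ψ) a = combine (χ a) (ψ a)

⊗-split : ∀ {r s} (χ : ℕ → Fin r) (ψ : ℕ → Fin s) {a b} →
  (χ ⊗ ψ) a ≡ (χ ⊗ ψ) b → χ a ≡ χ b × ψ a ≡ ψ b
⊗-split χ ψ {a} {b} = combine-injective (χ a) (ψ a) (χ b) (ψ b)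

positivity : ℕ → Fin 2
positivity zero    = zero
positivity (suc _) = suc zero

positivity-zero : ∀ {k} → positivity k ≡ zero → k ≡ 0
positivity-zero {zero} _ = refl

positivity-one : ∀ {k} → positivity k ≡ suc zero → 1 ≤ k
positivity-one {suc _} _ = s≤s z≤n

positive-positivity : ∀ {k} → 1 ≤ k → positivity k ≡ suc zero
positive-positivity (s≤s _) = refl

degreeBound : ∀ {n} → Poly n → ℕ
degreeBound P = suc (maxDegree (terms P))

module Colouring {p} (p-prime : Prime p) (K : ℕ) .{{_ : NonZero K}} where

  open PAdic p (prime>1 p-prime) public

  instance
    p≢0 : NonZero p
    p≢0 = prime⇒nonZero p-prime
    p^K≢0 : NonZero (p ^ K)
    p^K≢0 = m^n≢0 p K

  unitClass : ℕ → Fin p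
  unitClass a = unit a mod p
  positivityClass : ℕ → Fin 2
  positivityClass a = positivity (valuation a)
  valuation²Class : ℕ → Fin K
  valuation²Class a = valuation (valuation a) mod K
  valuationUnitClass : ℕ → Fin (p ^ K)
  valuationUnitClass a = unit (valuation a) mod p ^ K

  colour : ℕ → Fin (p * (2 * (K * p ^ K)))
  colour = unitClass ⊗ positivityClass ⊗ valuation²Class ⊗ valuationUnitClass

  record Alike (a b : ℕ) : Set where
    field
      unit≡           : unit a % p ≡ unit b % p
      positivity≡     : positivity (valuation a) ≡ positivity (valuation b)
      valuation²≡     : valuation (valuation a) % K ≡ valuation (valuation b) % K
      unit∘valuation≡ : unit (valuation a) % p ^ K ≡ unit (valuation b) % p ^ K

  alike : ∀ {a b} → colour a ≡ colour b → Alike a b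
  alike {a} {b} same
    with ⊗-split unitClass (positivityClass ⊗ valuation²Class ⊗ valuationUnitClass) {a} {b} same
  ... | unit-mod≡ , rest with ⊗-split positivityClass (valuation²Class ⊗ valuationUnitClass) {a} {b} rest
  ... | positivity≡ , rest′ with ⊗-split valuation²Class valuationUnitClass {a} {b} rest′
  ... | valuation²-mod≡ , unit∘valuation-mod≡ = record
    { unit≡           = mod-injective unit-mod≡
    ; positivity≡     = positivity≡
    ; valuation²≡     = mod-injective valuation²-mod≡
    ; unit∘valuation≡ = mod-injective unit∘valuation-mod≡
    }

-- A monochromatic solution yields a forbidden congruence.

module MonochromaticSolution {n} (P : Poly n) {p} (p-prime : Prime p)
  (a : Fin n → ℕ) (a≥1 : ∀ i → 1 ≤ a i) (i₀ : Fin n)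
  (monochromatic : ∀ i j → Colouring.colour p-prime (degreeBound P) (a i)
                          ≡ Colouring.colour p-prime (degreeBound P) (a j))
  (P[a]≡0 : eval P a ≡ + 0) where

  open Colouring p-prime (degreeBound P)
  open ModP p
  open Alike

  same : ∀ i j → Alike (a i) (a j)
  same i j = alike (monochromatic i j)

  v u : Fin n → ℕ
  v i = valuation (a i)
  u i = unit (a i)

  z : ℤ
  z = + u i₀

  p∤z : ¬ + p ∣ℤ z
  p∤z = unit-coprime (a≥1 i₀)

  lowest-layer-divisible : ∀ m → All (λ t → m ≤ weight (proj₂ t) v) (terms P) →
    + p ∣ℤ diagSum (layer v m (terms P)) z
  lowest-layer-divisible m m≤w =
    layer-divisible (terms P) a v u (valuation-unit ∘ a) (λ i → %-≈ (unit≡ (same i i₀))) m m≤w P[a]≡0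

  -- If p ∤ aᵢ then every term has weight 0: condition (1) is violated.
  unit-case : v i₀ ≡ 0 → + p ∣ℤ diagSum (terms P) z
  unit-case v₀≡0 =
    subst (λ J → + p ∣ℤ diagSum J z) whole-layer (lowest-layer-divisible 0 (All.tabulate λ _ → z≤n))
    where
    v≡0 : ∀ i → v i ≡ 0
    v≡0 i = positivity-zero (trans (positivity≡ (same i i₀)) (cong positivity v₀≡0))
    whole-layer : layer v 0 (terms P) ≡ terms P
    whole-layer = filter-all (weight≟ v 0) (All.tabulate λ {t} _ → weight-zero (proj₂ t) v≡0)

  lowest-layer-rado : 1 ≤ v i₀ → ∀ m → All (λ s → m ≤ weight (proj₂ s) v) (terms P) →
    layer v m (terms P) ≢ [] → RadoSetOfMinimal P (layer v m (terms P))
  lowest-layer-rado v₀≥1 m m≤w J≢[] =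
    J≢[] , filter-Sublist (weight≟ v m) ⊆-refl , layer-minimal P v v≥1 m m≤w , rado
    where
    J : List (Term n)
    J = layer v m (terms P)
    v≥1 : ∀ i → 1 ≤ v i
    v≥1 i = positivity-one (trans (positivity≡ (same i i₀)) (positive-positivity v₀≥1))
    degree< : ∀ {s} → s ∈ J → ∣ proj₂ s ∣ᵢ < p ^ degreeBound P
    degree< s∈J = <-trans (s≤s (maxDegree-≥ (proj₁ (∈-filter⁻ (weight≟ v m) {xs = terms P} s∈J))))
                          (n<p^n (prime>1 p-prime) (degreeBound P))
    weight≡m : ∀ {s} → s ∈ J → weight (proj₂ s) v ≡ m
    weight≡m s∈J = proj₂ (∈-filter⁻ (weight≟ v m) {xs = terms P} s∈J)
    open LevelSet p-prime (degreeBound P)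
    balancing : Σ (Subset n) λ Λ → Nonempty Λ ×
      (∀ α β → ∣ α ∣ᵢ < p ^ degreeBound P → ∣ β ∣ᵢ < p ^ degreeBound P →
        weight α v ≡ weight β v → sumOver Λ α ≡ sumOver Λ β)
    balancing = level-set-balances v (valuation ∘ v) (unit ∘ v) i₀ (valuation-unit ∘ v)
      (λ i → unit-coprime (v≥1 i)) (λ i j → valuation²≡ (same i j)) (λ i j → unit∘valuation≡ (same i j))
    rado : ∀ s s′ → s ∈ J → s′ ∈ J →
      Σ (Subset n) λ Λ → Nonempty Λ × sumOver Λ (proj₂ s) ≡ sumOver Λ (proj₂ s′)
    rado s s′ s∈J s′∈J = proj₁ balancing , proj₁ (proj₂ balancing) ,
      proj₂ (proj₂ balancing) (proj₂ s) (proj₂ s′) (degree< s∈J) (degree< s′∈J)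
        (trans (weight≡m s∈J) (sym (weight≡m s′∈J)))

some-index : ∀ {n} (a : Fin n → ℕ) → ¬ (∀ i j → a i ≡ a j) → Fin n
some-index {zero}  a nonConstant = ⊥-elim (nonConstant λ ())
some-index {suc n} a _           = zero

-- The colouring of the module Colouring, with K the degree bound of P, has no
-- monochromatic non-constant zero of P.  (The argument does not need that P
-- has no constant term.)
theorem3p6 : ∀ {n} (P : Poly n) → NoConstantTerm P →
    (p : ℕ) → Prime p →
    NoNonzeroSolutionMod p (terms P) →
    (∀ (J : List (Term n)) → RadoSetOfMinimal P J → NoNonzeroSolutionMod p J) →
    NotPRExceptConstant P
theorem3p6 {n} P _ p p-prime noSolution noRadoSolution = _ , colour , noMonochromaticSolution
  where
  open Colouring p-prime (degreeBound P)
  noMonochromaticSolution : ∀ a → (∀ i → 1 ≤ a i) → (∀ i j → colour (a i) ≡ colour (a j)) →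
    ¬ (∀ i j → a i ≡ a j) → eval P a ≢ + 0
  noMonochromaticSolution a a≥1 monochromatic nonConstant P[a]≡0 = by-valuation (v i₀ ≟ 0)
    where
    i₀ : Fin n
    i₀ = some-index a nonConstant
    open MonochromaticSolution P p-prime a a≥1 i₀ monochromatic P[a]≡0
    -- When p ∣ a_{i₀}: if P has no terms, condition (1) fails trivially;
    -- otherwise the lowest layer violates condition (2).
    by-terms : ∀ T → terms P ≡ T → 1 ≤ v i₀ → ⊥
    by-terms []      terms≡ _    =
      noSolution z p∤z (subst (λ T → + p ∣ℤ diagSum T z) (sym terms≡) (p ∣0))
    by-terms (t ∷ T) terms≡ v₀≥1 with lowest-weight v (terms P) terms≡
    ... | m , m≤w , nonempty =
      noRadoSolution _ (lowest-layer-rado v₀≥1 m m≤w nonempty) z p∤z (lowest-layer-divisible m m≤w)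
    -- The colour makes "p ∣ aᵢ" independent of i, so split on i₀.
    by-valuation : Dec (v i₀ ≡ 0) → ⊥
    by-valuation (yes v₀≡0) = noSolution z p∤z (unit-case v₀≡0)
    by-valuation (no  v₀≢0) = by-terms (terms P) refl (n≢0⇒n>0 v₀≢0)
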